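{- Let $L$ and $s$ be positive integers and let $V \subset \{s+1, \ldots, L+s\}$ with $|V| \geq 2$. Then for all integers $N \geq 2(L+s)^7 + (L+s)^5$, \[ |\{\pi \in I_{L,s,V} : |\pi| = N \}| \leq |\{\pi \in D_{L,s} : |\pi| = N\}|. \]
   Context: For a partition $\pi$, $|\pi|$ denotes the sum of its parts. $I_{L,s,V}$ is the set of integer partitions whose smallest part is $s$, all of whose parts are $\leq L+s$, and in which no element of $V$ appears as a part. $D_{L,s}$ is the set of nonempty integer partitions all of whose parts lie in $\{s+1, \ldots, L+s\}$. -}

module Defs where

open import Data.Nat using (ℕ; zero; suc; _+_; _≤_; _<_; _≤?_; _<?_)
open import Data.List using (List; []; _∷_; length; filter; concatMap; map; upTo)
open import Data.List.Relation.Unary.All using (All; all?)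
open import Data.List.Membership.Propositional using (_∈_)
open import Data.List.Membership.DecPropositional as DecMem using ()
open import Data.Nat.Properties using (_≟_)
open import Data.Product using (_×_; _,_)
open import Relation.Nullary using (¬_; Dec; yes; no)
open import Relation.Nullary.Decidable using (_×-dec_; ¬?)
open import Relation.Unary using (Pred; Decidable)
open import Function using (_∘_)
open import Relation.Binary.PropositionalEquality using (_≡_; refl)
open import Data.Nat.ListAction using (sum)

-- A partition is represented as a weakly decreasing list of positive
-- integers (its parts, largest first).

-- partitionsBounded n m : all partitions of n whose parts are all ≤ m,
-- each listed exactly once (weakly decreasing lists of positive parts).
-- Defined by structural recursion on a fuel argument f ≥ n.
pb : ℕ → ℕ → ℕ → List (List ℕ)
pb zero    zero    m = [] ∷ []
pb zero    (suc n) m = []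
pb (suc f) zero    m = [] ∷ []
pb (suc f) (suc n) m =
  concatMap (λ k → map (λ p → suc k ∷ p) (pb f (suc n Data.Nat.∸ suc k) (suc k)))
            (filter (λ k → suc k ≤? m) (filter (λ k → suc k ≤? suc n) (upTo (suc n))))

partitions : ℕ → List (List ℕ)
partitions n = pb n n n

size : List ℕ → ℕ
size = sum

data SmallestPart : List ℕ → ℕ → Set where
  last-one : ∀ {s} → SmallestPart (s ∷ []) s
  cons     : ∀ {x y ys s} → SmallestPart (y ∷ ys) s → SmallestPart (x ∷ y ∷ ys) s

smallestPart? : (π : List ℕ) (s : ℕ) → Dec (SmallestPart π s)
smallestPart? [] s = no (λ ())
smallestPart? (x ∷ []) s with x ≟ s
... | yes refl = yes last-one
... | no x≢s = no (λ { last-one → x≢s refl })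
smallestPart? (x ∷ y ∷ ys) s with smallestPart? (y ∷ ys) s
... | yes p = yes (cons p)
... | no ¬p = no (λ { (cons p) → ¬p p })

InI : ℕ → ℕ → List ℕ → List ℕ → Set
InI L s V π = SmallestPart π s × All (_≤ L + s) π × All (λ v → ¬ (v ∈ π)) V

InI? : (L s : ℕ) (V : List ℕ) → Decidable (InI L s V)
InI? L s V π =
  smallestPart? π s ×-dec all? (_≤? L + s) π ×-dec all? (λ v → ¬? (DecMem._∈?_ _≟_ v π)) V

data NonEmpty : List ℕ → Set where
  ne : ∀ {x xs} → NonEmpty (x ∷ xs)

nonEmpty? : Decidable NonEmpty
nonEmpty? [] = no (λ ())
nonEmpty? (x ∷ xs) = yes ne

InD : ℕ → ℕ → List ℕ → Set
InD L s π = NonEmpty π × All (λ x → s < x × x ≤ L + s) π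

InD? : (L s : ℕ) → Decidable (InD L s)
InD? L s π = nonEmpty? π ×-dec all? (λ x → (s <? x) ×-dec (x ≤? L + s)) π

countI : ℕ → ℕ → List ℕ → ℕ → ℕ
countI L s V N = length (filter (InI? L s V) (partitions N))

countD : ℕ → ℕ → ℕ → ℕ
countD L s N = length (filter (InD? L s) (partitions N))

{-# OPTIONS --safe #-}
-- A partition with parts ≤ M = L + s is recorded by its multiplicities c, with |π| = Σ i c i. Two elements
-- a < b of V are parts of no π ∈ I, and from them we get parts p, q ∈ {a, b} and a third part w
-- such that every T ≥ 2 M² is x p + r q + f(r) w with r < p. A partition in I is sent into D by removing
-- all its parts s (and, when these weigh less than 2 M², also k parts j with j c j large) and re-inserting
-- the removed weight T as x parts p, y parts q and f(y mod p) parts w. If parts j were removed, y is shifted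
-- by (1 + j + c s (M + 1)) p, so that y tells which case occurred and, in the second, also j and c s; then T
-- gives c s or k. Since p and q are not parts of π, the image shows x and y, so the map is injective.
module Submission where

open import Defs
open import Data.Nat
  using (ℕ; zero; suc; _+_; _∸_; _*_; _^_; _≤_; _<_; _≤?_; _<?_; z≤n; s≤s; NonZero; >-nonZero; _/_; _%_)
open import Data.Nat.Properties
open import Data.Nat.DivMod
open import Data.Nat.ListAction using (sum)
open import Data.Nat.ListAction.Properties using (sum-++)
open import Data.Nat.Tactic.RingSolver using (solve-∀)
open import Data.List using (List; []; _∷_; length; filter; concatMap; map; upTo; _++_; replicate)
open import Data.List.Properties using (∷-injectiveʳ; ∷-injectiveˡ)
open import Data.List.Relation.Unary.Any using (here; there)
open import Data.List.Relation.Unary.All as All using (All; []; _∷_)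
open import Data.List.Relation.Unary.AllPairs as AllPairs using ([]; _∷_)
import Data.List.Relation.Unary.AllPairs.Properties as AllPairs
import Data.List.Relation.Unary.All.Properties as All
open import Data.List.Relation.Unary.Unique.Propositional using (Unique)
import Data.List.Relation.Unary.Unique.Propositional.Properties as Unique
open import Data.List.Membership.Propositional using (_∈_; _∉_; find; lose)
open import Data.List.Membership.Propositional.Properties
open import Data.Product using (_×_; _,_; ∃; ∃₂; proj₁; proj₂)
open import Data.Sum using (_⊎_; inj₁; inj₂)
open import Data.Empty using (⊥-elim)
open import Relation.Nullary using (¬_; yes; no)
open import Relation.Binary using (tri<; tri≈; tri>)
open import Relation.Binary.PropositionalEquality
open import Function using (_∘′_)

data Descending : ℕ → List ℕ → Set where
  dnil  : ∀ {m} → Descending m []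
  dcons : ∀ {m x xs} → 1 ≤ x → x ≤ m → Descending x xs → Descending m (x ∷ xs)

Descending-weaken : ∀ {m m′ π} → m ≤ m′ → Descending m π → Descending m′ π
Descending-weaken m≤m′ dnil             = dnil
Descending-weaken m≤m′ (dcons 1≤x x≤m d) = dcons 1≤x (≤-trans x≤m m≤m′) d

Descending⇒All≤ : ∀ {m π} → Descending m π → All (_≤ m) π
Descending⇒All≤ dnil              = []
Descending⇒All≤ (dcons _ x≤m d) = x≤m ∷ All.map (λ y≤x → ≤-trans y≤x x≤m) (Descending⇒All≤ d)

Descending-tighten : ∀ {m m′ π} → Descending m π → All (_≤ m′) π → Descending m′ π
Descending-tighten dnil               _            = dnil
Descending-tighten (dcons 1≤x _ d) (x≤m′ ∷ _) = dcons 1≤x x≤m′ d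

headCandidates : ℕ → ℕ → List ℕ
headCandidates n m = filter (λ k → suc k ≤? m) (filter (λ k → suc k ≤? suc n) (upTo (suc n)))

withHead : ℕ → ℕ → ℕ → List (List ℕ)
withHead f n k = map (suc k ∷_) (pb f (suc n ∸ suc k) (suc k))

pb-sound : ∀ f n m {π} → π ∈ pb f n m → Descending m π × sum π ≡ n
pb-sound zero    zero    m (here refl) = dnil , refl
pb-sound (suc f) zero    m (here refl) = dnil , refl
pb-sound (suc f) (suc n) m π∈
  with k , k∈ , π∈k ← find (∈-concatMap⁻ (withHead f n) {xs = headCandidates n m} π∈)
  with k∈′ , k<m ← ∈-filter⁻ (λ k → suc k ≤? m) {xs = filter (λ k → suc k ≤? suc n) (upTo (suc n))} k∈
  with _ , s≤s k≤n ← ∈-filter⁻ (λ k → suc k ≤? suc n) {xs = upTo (suc n)} k∈′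
  with ρ , ρ∈ , refl ← ∈-map⁻ (suc k ∷_) π∈k
  with d , sumρ ← pb-sound f (n ∸ k) (suc k) ρ∈
  = dcons (s≤s z≤n) k<m d , cong suc (trans (cong (k +_) sumρ) (m+[n∸m]≡n k≤n))

pb-complete : ∀ f n m {π} → Descending m π → sum π ≡ n → n ≤ f → π ∈ pb f n m
pb-complete zero    zero    m dnil refl _ = here refl
pb-complete (suc f) zero    m dnil refl _ = here refl
pb-complete (suc f) (suc n) m {suc k ∷ ρ} (dcons _ k<m d) sumπ (s≤s n≤f) =
  ∈-concatMap⁺ (withHead f n) {xs = headCandidates n m}
    (lose (∈-filter⁺ (λ k → suc k ≤? m) (∈-filter⁺ (λ k → suc k ≤? suc n) (∈-upTo⁺ (s≤s k≤n)) (s≤s k≤n)) k<m)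
          (∈-map⁺ (suc k ∷_) (pb-complete f (n ∸ k) (suc k) d sumρ (≤-trans (m∸n≤m n k) n≤f))))
  where
  k≤n : k ≤ n
  k≤n = ≤-trans (m≤m+n k (sum ρ)) (≤-reflexive (suc-injective sumπ))
  sumρ : sum ρ ≡ n ∸ k
  sumρ = trans (sym (m+n∸m≡n k (sum ρ))) (cong (_∸ k) (suc-injective sumπ))
pb-complete zero (suc n) m _ _ ()
pb-complete f (suc n) m dnil () _
pb-complete f zero m (dcons (s≤s z≤n) _ _) () _

pb-unique : ∀ f n m → Unique (pb f n m)
pb-unique zero    zero    m = [] ∷ []
pb-unique zero    (suc n) m = []
pb-unique (suc f) zero    m = [] ∷ []
pb-unique (suc f) (suc n) m =
  Unique.concat⁺ (All.map⁺ (All.tabulate (λ {k} _ → Unique.map⁺ ∷-injectiveʳ (pb-unique f (n ∸ k) (suc k)))))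
    (AllPairs.map⁺ (AllPairs.map disjoint
      (Unique.filter⁺ (λ k → suc k ≤? m) (Unique.filter⁺ (λ k → suc k ≤? suc n) (Unique.upTo⁺ (suc n))))))
  where
  disjoint : ∀ {j k} → j ≢ k → ∀ {π} → ¬ (π ∈ withHead f n j × π ∈ withHead f n k)
  disjoint j≢k (π∈j , π∈k) with _ , _ , refl ← ∈-map⁻ _ π∈j | _ , _ , eq ← ∈-map⁻ _ π∈k =
    j≢k (suc-injective (∷-injectiveˡ eq))

length-≤-injection : ∀ {A B : Set} {xs : List A} → Unique xs → (ys : List B) (F : ∀ {x} → x ∈ xs → B) →
  (∀ {x} (x∈ : x ∈ xs) → F x∈ ∈ ys) → (∀ {x y} (x∈ : x ∈ xs) (y∈ : y ∈ xs) → F x∈ ≡ F y∈ → x ≡ y) →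
  length xs ≤ length ys
length-≤-injection {xs = []} _ ys F F∈ F-inj = z≤n
length-≤-injection {xs = x ∷ xs} (x∉xs ∷ u) ys F F∈ F-inj
  with ys₁ , ys₂ , refl ← ∈-∃++ (F∈ (here refl)) =
  ≤-trans (s≤s (length-≤-injection u (ys₁ ++ ys₂) (F ∘′ there) F∈′ (λ x∈ y∈ → F-inj (there x∈) (there y∈))))
          (≤-reflexive (sym (length-middle ys₁ ys₂)))
  where
  length-middle : ∀ {B : Set} (us vs : List B) {v} → length (us ++ v ∷ vs) ≡ suc (length (us ++ vs))
  length-middle []       vs = refl
  length-middle (u ∷ us) vs = cong suc (length-middle us vs)
  F∈′ : ∀ {y} (y∈ : y ∈ xs) → F (there y∈) ∈ ys₁ ++ ys₂
  F∈′ y∈ with ∈-++⁻ ys₁ (F∈ (there y∈))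
  ... | inj₁ m         = ∈-++⁺ˡ m
  ... | inj₂ (here eq) = ⊥-elim (All.lookup x∉xs y∈ (sym (F-inj (there y∈) (here refl) eq)))
  ... | inj₂ (there m) = ∈-++⁺ʳ ys₁ m

multiplicity : List ℕ → ℕ → ℕ
multiplicity []       i = 0
multiplicity (x ∷ xs) i with x ≟ i
... | yes _ = suc (multiplicity xs i)
... | no  _ = multiplicity xs i

multiplicity-++ : ∀ xs ys i → multiplicity (xs ++ ys) i ≡ multiplicity xs i + multiplicity ys i
multiplicity-++ []       ys i = refl
multiplicity-++ (x ∷ xs) ys i with x ≟ i
... | yes _ = cong suc (multiplicity-++ xs ys i)
... | no  _ = multiplicity-++ xs ys i

multiplicity-replicate : ∀ n x → multiplicity (replicate n x) x ≡ n
multiplicity-replicate zero    x = refl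
multiplicity-replicate (suc n) x with x ≟ x
... | yes _   = cong suc (multiplicity-replicate n x)
... | no  x≢x = ⊥-elim (x≢x refl)

∉⇒multiplicity≡0 : ∀ {π i} → i ∉ π → multiplicity π i ≡ 0
∉⇒multiplicity≡0 {[]}    i∉ = refl
∉⇒multiplicity≡0 {x ∷ π} {i} i∉ with x ≟ i
... | yes refl = ⊥-elim (i∉ (here refl))
... | no  _    = ∉⇒multiplicity≡0 (i∉ ∘′ there)

∈-replicate⁻ : ∀ {n x i : ℕ} → i ∈ replicate n x → i ≡ x × n ≢ 0
∈-replicate⁻ {suc n} (here refl) = refl , λ ()
∈-replicate⁻ {suc n} (there i∈) = proj₁ (∈-replicate⁻ i∈) , λ ()

multiplicity-replicate-≢ : ∀ n {x i} → x ≢ i → multiplicity (replicate n x) i ≡ 0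
multiplicity-replicate-≢ n {x} x≢i = ∉⇒multiplicity≡0 {replicate n x} (λ i∈ → x≢i (sym (proj₁ (∈-replicate⁻ i∈))))

fromMultiplicities : ℕ → (ℕ → ℕ) → List ℕ
fromMultiplicities zero    c = []
fromMultiplicities (suc M) c = replicate (c (suc M)) (suc M) ++ fromMultiplicities M c

∈-fromMultiplicities⁻ : ∀ M c {i} → i ∈ fromMultiplicities M c → 1 ≤ i × i ≤ M × c i ≢ 0
∈-fromMultiplicities⁻ (suc M) c i∈ with ∈-++⁻ (replicate (c (suc M)) (suc M)) i∈
... | inj₁ i∈rep with refl , c≢0 ← ∈-replicate⁻ i∈rep = s≤s z≤n , ≤-refl , c≢0
... | inj₂ i∈′ with 1≤i , i≤M , ci≢0 ← ∈-fromMultiplicities⁻ M c i∈′ = 1≤i , m≤n⇒m≤1+n i≤M , ci≢0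

_≗⟨_⟩_ : (ℕ → ℕ) → ℕ → (ℕ → ℕ) → Set
c ≗⟨ M ⟩ d = ∀ {i} → 1 ≤ i → i ≤ M → c i ≡ d i

≗-pred : ∀ {c d M} → c ≗⟨ suc M ⟩ d → c ≗⟨ M ⟩ d
≗-pred c≗d 1≤i i≤M = c≗d 1≤i (m≤n⇒m≤1+n i≤M)

multiplicity-fromMultiplicities : ∀ M c → multiplicity (fromMultiplicities M c) ≗⟨ M ⟩ c
multiplicity-fromMultiplicities zero    c 1≤i i≤0 = ⊥-elim (1+n≰n (≤-trans 1≤i i≤0))
multiplicity-fromMultiplicities (suc M) c {i} 1≤i i≤1+M with i ≟ suc M
... | yes refl = begin
  multiplicity (replicate (c i) i ++ fromMultiplicities M c) i
    ≡⟨ multiplicity-++ (replicate (c i) i) _ i ⟩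
  multiplicity (replicate (c i) i) i + multiplicity (fromMultiplicities M c) i
    ≡⟨ cong₂ _+_ (multiplicity-replicate (c i) i) (∉⇒multiplicity≡0 (λ i∈ → 1+n≰n (proj₁ (proj₂ (∈-fromMultiplicities⁻ M c i∈))))) ⟩
  c i + 0
    ≡⟨ +-identityʳ (c i) ⟩
  c i ∎
  where
  open ≡-Reasoning
... | no i≢1+M = begin
  multiplicity (replicate (c (suc M)) (suc M) ++ fromMultiplicities M c) i
    ≡⟨ multiplicity-++ (replicate (c (suc M)) (suc M)) _ i ⟩
  multiplicity (replicate (c (suc M)) (suc M)) i + multiplicity (fromMultiplicities M c) i
    ≡⟨ cong₂ _+_ (multiplicity-replicate-≢ (c (suc M)) (i≢1+M ∘′ sym))
                 (multiplicity-fromMultiplicities M c 1≤i (≤-pred (≤∧≢⇒< i≤1+M i≢1+M))) ⟩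
  c i ∎
  where
  open ≡-Reasoning

fromMultiplicities-cong : ∀ M {c d} → c ≗⟨ M ⟩ d → fromMultiplicities M c ≡ fromMultiplicities M d
fromMultiplicities-cong zero    c≗d = refl
fromMultiplicities-cong (suc M) c≗d =
  cong₂ (λ n rest → replicate n (suc M) ++ rest) (c≗d (s≤s z≤n) ≤-refl) (fromMultiplicities-cong M (≗-pred c≗d))

Descending-replicate : ∀ n {m x ys} → 1 ≤ x → x ≤ m → Descending x ys → Descending m (replicate n x ++ ys)
Descending-replicate zero    1≤x x≤m d = Descending-weaken x≤m d
Descending-replicate (suc n) 1≤x x≤m d = dcons 1≤x x≤m (Descending-replicate n 1≤x ≤-refl d)

Descending-fromMultiplicities : ∀ M c → Descending M (fromMultiplicities M c)
Descending-fromMultiplicities zero    c = dnil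
Descending-fromMultiplicities (suc M) c =
  Descending-replicate (c (suc M)) (s≤s z≤n) ≤-refl (Descending-weaken (n≤1+n M) (Descending-fromMultiplicities M c))

Descending-split : ∀ {M π} → Descending (suc M) π →
  ∃ λ π′ → π ≡ replicate (multiplicity π (suc M)) (suc M) ++ π′ × Descending M π′
Descending-split dnil = [] , refl , dnil
Descending-split {M} (dcons {x = x} {xs} 1≤x x≤1+M d) with x ≟ suc M
... | yes refl with π′ , xs≡ , d′ ← Descending-split d = π′ , cong (suc M ∷_) xs≡ , d′
... | no x≢1+M = x ∷ xs , cong (λ n → replicate n (suc M) ++ x ∷ xs) (sym xs-below) , dcons 1≤x x≤M d
  where
  x≤M : x ≤ M
  x≤M = ≤-pred (≤∧≢⇒< x≤1+M x≢1+M)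
  xs-below : multiplicity xs (suc M) ≡ 0
  xs-below = ∉⇒multiplicity≡0 (λ 1+M∈ → 1+n≰n (≤-trans (All.lookup (Descending⇒All≤ d) 1+M∈) x≤M))

fromMultiplicities-multiplicity : ∀ M {π} → Descending M π → fromMultiplicities M (multiplicity π) ≡ π
fromMultiplicities-multiplicity zero    dnil = refl
fromMultiplicities-multiplicity zero    (dcons 1≤x x≤0 _) = ⊥-elim (1+n≰n (≤-trans 1≤x x≤0))
fromMultiplicities-multiplicity (suc M) {π} d with π′ , π≡ , d′ ← Descending-split d = begin
  replicate k (suc M) ++ fromMultiplicities M (multiplicity π) ≡⟨ cong (replicate k (suc M) ++_) (fromMultiplicities-cong M agree) ⟩
  replicate k (suc M) ++ fromMultiplicities M (multiplicity π′) ≡⟨ cong (replicate k (suc M) ++_) (fromMultiplicities-multiplicity M d′) ⟩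
  replicate k (suc M) ++ π′                                     ≡⟨ sym π≡ ⟩
  π ∎
  where
  open ≡-Reasoning
  k : ℕ
  k = multiplicity π (suc M)
  agree : multiplicity π ≗⟨ M ⟩ multiplicity π′
  agree {i} _ i≤M = begin
    multiplicity π i                                                  ≡⟨ cong (λ l → multiplicity l i) π≡ ⟩
    multiplicity (replicate k (suc M) ++ π′) i                        ≡⟨ multiplicity-++ (replicate k (suc M)) π′ i ⟩
    multiplicity (replicate k (suc M)) i + multiplicity π′ i          ≡⟨ cong (_+ multiplicity π′ i) (multiplicity-replicate-≢ k (λ 1+M≡i → 1+n≰n (subst (_≤ M) (sym 1+M≡i) i≤M))) ⟩
    multiplicity π′ i ∎

weight : ℕ → (ℕ → ℕ) → ℕ
weight zero    c = 0
weight (suc M) c = suc M * c (suc M) + weight M c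

sum-replicate : ∀ n x → sum (replicate n x) ≡ n * x
sum-replicate zero    x = refl
sum-replicate (suc n) x = cong (x +_) (sum-replicate n x)

sum-fromMultiplicities : ∀ M c → sum (fromMultiplicities M c) ≡ weight M c
sum-fromMultiplicities zero    c = refl
sum-fromMultiplicities (suc M) c = begin
  sum (replicate (c (suc M)) (suc M) ++ fromMultiplicities M c)       ≡⟨ sum-++ (replicate (c (suc M)) (suc M)) _ ⟩
  sum (replicate (c (suc M)) (suc M)) + sum (fromMultiplicities M c)  ≡⟨ cong₂ _+_ (sum-replicate (c (suc M)) (suc M)) (sum-fromMultiplicities M c) ⟩
  c (suc M) * suc M + weight M c                                      ≡⟨ cong (_+ weight M c) (*-comm (c (suc M)) (suc M)) ⟩
  suc M * c (suc M) + weight M c ∎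
  where
  open ≡-Reasoning

weight-cong : ∀ M {c d} → c ≗⟨ M ⟩ d → weight M c ≡ weight M d
weight-cong zero    c≗d = refl
weight-cong (suc M) c≗d = cong₂ (λ n w → suc M * n + w) (c≗d (s≤s z≤n) ≤-refl) (weight-cong M (≗-pred c≗d))

infixl 5 _[_]≔_ _[_]+=_ _[_]∸=_

_[_]≔_ : (ℕ → ℕ) → ℕ → ℕ → ℕ → ℕ
(c [ j ]≔ v) i with i ≟ j
... | yes _ = v
... | no  _ = c i

_[_]+=_ : (ℕ → ℕ) → ℕ → ℕ → ℕ → ℕ
c [ j ]+= t = c [ j ]≔ c j + t

_[_]∸=_ : (ℕ → ℕ) → ℕ → ℕ → ℕ → ℕ
c [ j ]∸= t = c [ j ]≔ c j ∸ t

≔-≡ : ∀ c j v → (c [ j ]≔ v) j ≡ v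
≔-≡ c j v with j ≟ j
... | yes _   = refl
... | no  j≢j = ⊥-elim (j≢j refl)

≔-≢ : ∀ c {j v i} → i ≢ j → (c [ j ]≔ v) i ≡ c i
≔-≢ c {j} {i = i} i≢j with i ≟ j
... | yes i≡j = ⊥-elim (i≢j i≡j)
... | no  _   = refl

weight-≔ : ∀ M c {j} v → j ≤ M → weight M (c [ j ]≔ v) + j * c j ≡ weight M c + j * v
weight-≔ zero    c v z≤n = refl
weight-≔ (suc M) c {j} v j≤1+M with suc M ≟ j
... | yes refl = begin
  suc M * v + weight M (c [ j ]≔ v) + j * c j ≡⟨ cong (λ w → suc M * v + w + j * c j) (weight-cong M below) ⟩
  suc M * v + weight M c + j * c j            ≡⟨ swap (suc M * v) (weight M c) (j * c j) ⟩
  j * c j + weight M c + suc M * v ∎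
  where
  open ≡-Reasoning
  below : (c [ j ]≔ v) ≗⟨ M ⟩ c
  below _ i≤M = ≔-≢ c (λ i≡j → 1+n≰n (subst (_≤ M) i≡j i≤M))
  swap : ∀ a b d → a + b + d ≡ d + b + a
  swap = solve-∀
... | no 1+M≢j = begin
  suc M * c (suc M) + weight M (c [ j ]≔ v) + j * c j   ≡⟨ +-assoc (suc M * c (suc M)) _ _ ⟩
  suc M * c (suc M) + (weight M (c [ j ]≔ v) + j * c j) ≡⟨ cong (suc M * c (suc M) +_) (weight-≔ M c v j≤M) ⟩
  suc M * c (suc M) + (weight M c + j * v)              ≡⟨ +-assoc (suc M * c (suc M)) _ _ ⟨
  suc M * c (suc M) + weight M c + j * v ∎
  where
  open ≡-Reasoning
  j≤M : j ≤ M
  j≤M = ≤-pred (≤∧≢⇒< j≤1+M (λ j≡1+M → 1+M≢j (sym j≡1+M)))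

weight-+= : ∀ M c {j} t → j ≤ M → weight M (c [ j ]+= t) ≡ weight M c + j * t
weight-+= M c {j} t j≤M = +-cancelʳ-≡ (j * c j) _ _ (begin
  weight M (c [ j ]+= t) + j * c j  ≡⟨ weight-≔ M c (c j + t) j≤M ⟩
  weight M c + j * (c j + t)        ≡⟨ rearrange (weight M c) j (c j) t ⟩
  weight M c + j * t + j * c j ∎)
  where
  open ≡-Reasoning
  rearrange : ∀ w j a t → w + j * (a + t) ≡ w + j * t + j * a
  rearrange = solve-∀

weight-∸= : ∀ M c {j t} → j ≤ M → t ≤ c j → weight M (c [ j ]∸= t) + j * t ≡ weight M c
weight-∸= M c {j} {t} j≤M t≤cj = +-cancelʳ-≡ (j * (c j ∸ t)) _ _ (begin
  weight M (c [ j ]∸= t) + j * t + j * (c j ∸ t)  ≡⟨ +-assoc (weight M (c [ j ]∸= t)) _ _ ⟩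
  weight M (c [ j ]∸= t) + (j * t + j * (c j ∸ t)) ≡⟨ cong (weight M (c [ j ]∸= t) +_) (*-distribˡ-+ j t (c j ∸ t)) ⟨
  weight M (c [ j ]∸= t) + j * (t + (c j ∸ t))     ≡⟨ cong (λ n → weight M (c [ j ]∸= t) + j * n) (m+[n∸m]≡n t≤cj) ⟩
  weight M (c [ j ]∸= t) + j * c j                 ≡⟨ weight-≔ M c (c j ∸ t) j≤M ⟩
  weight M c + j * (c j ∸ t) ∎)
  where
  open ≡-Reasoning

+=-zero : ∀ c j i → (c [ j ]+= 0) i ≡ c i
+=-zero c j i with i ≟ j
... | yes refl = +-identityʳ (c i)
... | no  _    = refl

+=-cancel : ∀ c₁ c₂ j t i → (c₁ [ j ]+= t) i ≡ (c₂ [ j ]+= t) i → c₁ i ≡ c₂ i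
+=-cancel c₁ c₂ j t i eq with i ≟ j
... | yes refl = +-cancelʳ-≡ t (c₁ i) (c₂ i) eq
... | no  _    = eq

∸=-cancel : ∀ c₁ c₂ j t i → t ≤ c₁ j → t ≤ c₂ j → (c₁ [ j ]∸= t) i ≡ (c₂ [ j ]∸= t) i → c₁ i ≡ c₂ i
∸=-cancel c₁ c₂ j t i t≤c₁ t≤c₂ eq with i ≟ j
... | yes refl = ∸-cancelʳ-≡ t≤c₁ t≤c₂ eq
... | no  _    = eq

∸=-≤ : ∀ c j t i → (c [ j ]∸= t) i ≤ c i
∸=-≤ c j t i with i ≟ j
... | yes refl = m∸n≤m (c i) t
... | no  _    = ≤-refl

weight-pigeonhole : ∀ M c B → M * B < weight M c → ∃ λ i → i ≤ M × B < i * c i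
weight-pigeonhole zero    c B ()
weight-pigeonhole (suc M) c B MB<w with B <? suc M * c (suc M)
... | yes B<top = suc M , ≤-refl , B<top
... | no  B≮top
  with i , i≤M , B<ici ← weight-pigeonhole M c B
         (+-cancelˡ-< B _ _ (<-≤-trans MB<w (+-monoˡ-≤ (weight M c) (≮⇒≥ B≮top))))
  = i , m≤n⇒m≤1+n i≤M , B<ici

record Representation (s M a b : ℕ) : Set where
  field
    p q w : ℕ
    f : ℕ → ℕ
    p∈ab : p ≡ a ⊎ p ≡ b
    q∈ab : q ≡ a ⊎ q ≡ b
    s<p : s < p
    s<q : s < q
    p≤M : p ≤ M
    q≤M : q ≤ M
    w≤M : w ≤ M
    p≢q : p ≢ q
    w≢p : w ≢ p
    w≢q : w ≢ q
    s<w⊎f≡0 : s < w ⊎ (∀ r → f r ≡ 0)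
    represent : ∀ T → 2 * M * M ≤ T → ∃₂ λ x r → r < p × T ≡ x * p + r * q + f r * w

quotient-large : ∀ {M p} T .{{_ : NonZero p}} → p ≤ M → 2 * M * M ≤ T → 2 * M ≤ T / p
quotient-large {M} {p} T p≤M 2MM≤T =
  subst (_≤ T / p) (m*n/n≡m (2 * M) p) (/-monoˡ-≤ p (≤-trans (*-monoʳ-≤ (2 * M) p≤M) 2MM≤T))

-- T = x a + r (a + 1) with r = T mod a.
representation-consecutive : ∀ {s M a′} → s < suc a′ → suc (suc a′) ≤ M →
  Representation s M (suc a′) (suc (suc a′))
representation-consecutive {s} {M} {a′} s<a b≤M = record
  { p = a ; q = suc a ; w = 0 ; f = λ _ → 0
  ; p∈ab = inj₁ refl ; q∈ab = inj₂ refl ; s<p = s<a ; s<q = m≤n⇒m≤1+n s<a ; p≤M = a≤M ; q≤M = b≤M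
  ; w≤M = z≤n ; p≢q = <⇒≢ (n<1+n a) ; w≢p = λ () ; w≢q = λ () ; s<w⊎f≡0 = inj₂ (λ _ → refl)
  ; represent = represent }
  where
  a : ℕ
  a = suc a′
  a≤M : a ≤ M
  a≤M = ≤-trans (n≤1+n a) b≤M
  represent : ∀ T → 2 * M * M ≤ T → ∃₂ λ x r → r < a × T ≡ x * a + r * suc a + 0 * 0
  represent T 2MM≤T = T / a ∸ T % a , T % a , m%n<n T a , (begin
    T                                   ≡⟨ m≡m%n+[m/n]*n T a ⟩
    T % a + T / a * a                   ≡⟨ cong (λ t → T % a + t * a) (m∸n+n≡m r≤t) ⟨
    T % a + (T / a ∸ T % a + T % a) * a ≡⟨ regroup (T / a ∸ T % a) (T % a) a ⟩
    (T / a ∸ T % a) * a + T % a * suc a + 0 * 0 ∎)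
    where
    open ≡-Reasoning
    r≤t : T % a ≤ T / a
    r≤t = ≤-trans (m%n≤n T a) (≤-trans a≤M (≤-trans (m≤m+n M (M + 0)) (quotient-large T a≤M 2MM≤T)))
    regroup : ∀ x r a → r + (x + r) * a ≡ x * a + r * suc a + 0 * 0
    regroup = solve-∀

-- With r = T mod b and r (a - 1) = h b + v (v < b):  T = x b + r a + v (b - 1).
representation-gap : ∀ {s M a′ b′} → s < suc a′ → suc a′ < suc b′ → suc b′ ≢ suc (suc a′) → suc b′ ≤ M →
  Representation s M (suc a′) (suc b′)
representation-gap {s} {M} {a′} {b′} s<a a<b b≢1+a b≤M = record
  { p = b ; q = a ; w = b′ ; f = λ r → (r * a′) % b
  ; p∈ab = inj₂ refl ; q∈ab = inj₁ refl ; s<p = <-trans s<a a<b ; s<q = s<a ; p≤M = b≤M ; q≤M = a≤M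
  ; w≤M = ≤-trans (n≤1+n b′) b≤M ; p≢q = (<⇒≢ a<b) ∘′ sym ; w≢p = <⇒≢ (n<1+n b′) ; w≢q = b≢1+a ∘′ cong suc
  ; s<w⊎f≡0 = inj₁ (<-≤-trans s<a (≤-pred a<b))
  ; represent = represent }
  where
  a b : ℕ
  a = suc a′
  b = suc b′
  a≤M : a ≤ M
  a≤M = ≤-trans (<⇒≤ a<b) b≤M
  represent : ∀ T → 2 * M * M ≤ T → ∃₂ λ x r → r < b × T ≡ x * b + r * a + ((r * a′) % b) * b′
  represent T 2MM≤T = t ∸ (v + h) , r , m%n<n T b , (begin
    T                                         ≡⟨ m≡m%n+[m/n]*n T b ⟩
    r + t * b                                 ≡⟨ cong (λ t → r + t * b) (m∸n+n≡m v+h≤t) ⟨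
    r + (t ∸ (v + h) + (v + h)) * b           ≡⟨ regroup (t ∸ (v + h)) r v h b′ ⟩
    (t ∸ (v + h)) * b + r + (v + h * b) + v * b′ ≡⟨ cong (λ m → (t ∸ (v + h)) * b + r + m + v * b′) (m≡m%n+[m/n]*n (r * a′) b) ⟨
    (t ∸ (v + h)) * b + r + r * a′ + v * b′   ≡⟨ ungroup (t ∸ (v + h)) r v a′ b′ ⟩
    (t ∸ (v + h)) * b + r * a + v * b′ ∎)
    where
    open ≡-Reasoning
    r t v h : ℕ
    r = T % b
    t = T / b
    v = (r * a′) % b
    h = (r * a′) / b
    h≤a′ : h ≤ a′
    h≤a′ = subst (h ≤_) (m*n/n≡m a′ b) (/-monoˡ-≤ b (subst (r * a′ ≤_) (*-comm b a′) (*-monoˡ-≤ a′ (m%n≤n T b))))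
    v+h≤t : v + h ≤ t
    v+h≤t = ≤-trans (+-mono-≤ (≤-trans (m%n≤n (r * a′) b) b≤M) (≤-trans h≤a′ (≤-trans (n≤1+n a′) (≤-trans a≤M (m≤m+n M 0)))))
                    (quotient-large T b≤M 2MM≤T)
    regroup : ∀ x r v h b′ → r + (x + (v + h)) * suc b′ ≡ x * suc b′ + r + (v + h * suc b′) + v * b′
    regroup = solve-∀
    ungroup : ∀ x r v a′ b′ → x * suc b′ + r + r * a′ + v * b′ ≡ x * suc b′ + r * suc a′ + v * b′
    ungroup = solve-∀

representation : ∀ {s M a b} → s < a → a < b → b ≤ M → Representation s M a b
representation {a = suc a′} {suc b′} s<a a<b b≤M with suc b′ ≟ suc (suc a′)
... | yes refl   = representation-consecutive s<a b≤M
... | no b≢1+a = representation-gap s<a a<b b≢1+a b≤M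

[m+kn]%n≡m : ∀ {m} k {n} .{{_ : NonZero n}} → m < n → (m + k * n) % n ≡ m
[m+kn]%n≡m {m} k {n} m<n = trans ([m+kn]%n≡m%n m k n) (m<n⇒m%n≡m m<n)

[m+kn]/n≡k : ∀ {m} k {n} .{{_ : NonZero n}} → m < n → (m + k * n) / n ≡ k
[m+kn]/n≡k {m} k {n} m<n = begin
  (m + k * n) / n    ≡⟨ +-distrib-/ m (k * n) remainders<n ⟩
  m / n + k * n / n  ≡⟨ cong₂ _+_ (m<n⇒m/n≡0 m<n) (m*n/n≡m k n) ⟩
  k ∎
  where
  open ≡-Reasoning
  remainders<n : m % n + k * n % n < n
  remainders<n = subst₂ (λ u v → u + v < n) (sym (m<n⇒m%n≡m m<n)) (sym (m*n%n≡0 k n))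
                       (subst (_< n) (sym (+-identityʳ m)) m<n)

m<[1+m/n]*n : ∀ m n .{{_ : NonZero n}} → m < suc (m / n) * n
m<[1+m/n]*n m n = begin-strict
  m                  ≡⟨ m≡m%n+[m/n]*n m n ⟩
  m % n + m / n * n  <⟨ +-monoˡ-< (m / n * n) (m%n<n m n) ⟩
  n + m / n * n      ∎
  where
  open ≤-Reasoning

n*[1+m/n]≤n+m : ∀ m n .{{_ : NonZero n}} → n * suc (m / n) ≤ n + m
n*[1+m/n]≤n+m m n = begin
  n * suc (m / n)  ≡⟨ *-suc n (m / n) ⟩
  n + n * (m / n)  ≤⟨ +-monoʳ-≤ n (subst (_≤ m) (*-comm (m / n) n) (m/n*n≤m m n)) ⟩
  n + m            ∎
  where
  open ≤-Reasoning

-- Every T ≥ K₀ is represented; Q-max bounds K₀ + (1 + j + c s (M + 1)) p q; and a partition of N ≥ N₀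
-- whose parts s weigh less than K₀ has a part j with j c j > Q-max + M.
module Thresholds (M : ℕ) where
  K₀ : ℕ
  K₀ = 2 * M * M

  Q-max : ℕ
  Q-max = K₀ + K₀ * suc M * M * M

  N₀ : ℕ
  N₀ = K₀ + M * (Q-max + M)

N₀≤2M⁷+M⁵ : ∀ M → 2 ≤ M → Thresholds.N₀ M ≤ 2 * M ^ 7 + M ^ 5
N₀≤2M⁷+M⁵ 1 (s≤s ())
N₀≤2M⁷+M⁵ (suc (suc m)) _ = ≤-trans (m≤m+n (Thresholds.N₀ (2 + m)) (slack m)) (≤-reflexive (sym (expand m)))
  where
  -- 2 M⁷ + M⁵ - N₀, written in n = M - 2 so that it is visibly a natural number
  slack : ℕ → ℕ
  slack n = 2 * n * (2 + n) * (2 + n) * (2 + n) * (2 + n) * (2 + n) * (2 + n) + 2 * n * (2 + n) * (2 + n) * (2 + n) * (2 + n) * (2 + n)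
    + (2 + n) * (2 + n) * (3 * n * (2 + n) * (2 + n) + 6 * n * (2 + n) + 10 * n + 17)
  expand : ∀ n → 2 * ((2 + n) * ((2 + n) * ((2 + n) * ((2 + n) * ((2 + n) * ((2 + n) * ((2 + n) * (1)))))))) + (2 + n) * ((2 + n) * ((2 + n) * ((2 + n) * ((2 + n) * (1)))))
    ≡ 2 * (2 + n) * (2 + n) + (2 + n) * (2 * (2 + n) * (2 + n) + 2 * (2 + n) * (2 + n) * (3 + n) * (2 + n) * (2 + n) + (2 + n))
      + (2 * n * (2 + n) * (2 + n) * (2 + n) * (2 + n) * (2 + n) * (2 + n) + 2 * n * (2 + n) * (2 + n) * (2 + n) * (2 + n) * (2 + n)
        + (2 + n) * (2 + n) * (3 * n * (2 + n) * (2 + n) + 6 * n * (2 + n) + 10 * n + 17))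
  expand = solve-∀

module Encoding (s M : ℕ) .{{_ : NonZero s}} {a b : ℕ} (R : Representation s M a b) where
  open Representation R
  open Thresholds M public

  1≤p : 1 ≤ p
  1≤p = ≤-trans (s≤s z≤n) s<p

  1≤q : 1 ≤ q
  1≤q = ≤-trans (s≤s z≤n) s<q

  s≤M : s ≤ M
  s≤M = ≤-trans (n≤1+n s) (≤-trans s<p p≤M)

  instance
    p-nonZero : NonZero p
    p-nonZero = >-nonZero 1≤p

  strip : (ℕ → ℕ) → ℕ → ℕ → ℕ → ℕ
  strip c j k = c [ s ]∸= c s [ j ]∸= k

  transform : (ℕ → ℕ) → ℕ → ℕ → ℕ → ℕ → ℕ → ℕ → ℕ
  transform c j k x y z = strip c j k [ p ]+= x [ q ]+= y [ w ]+= z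

  -- The two shapes of the part y of q: y < p when only the parts s are removed (j = s), and otherwise
  -- y div p = 1 + (j + c s (M + 1)), from which j and c s are read off.
  record Plan (c : ℕ → ℕ) : Set where
    field
      j k x y z : ℕ
      j≤M : j ≤ M
      k≤ : k ≤ (c [ s ]∸= c s) j
      balance : c s * s + k * j ≡ x * p + y * q + z * w
      z≡f : z ≡ f (y % p)
      tag : (j ≡ s × k ≡ 0 × y < p) ⊎ (1 ≤ j × y / p ≡ suc (j + c s * suc M))

  image : ∀ {c} → Plan c → ℕ → ℕ
  image {c} P = let open Plan P in transform c j k x y z

  weight-strip : ∀ c {j k} → j ≤ M → k ≤ (c [ s ]∸= c s) j → weight M (strip c j k) + (c s * s + k * j) ≡ weight M c
  weight-strip c {j} {k} j≤M k≤ = begin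
    weight M (strip c j k) + (c s * s + k * j)        ≡⟨ cong (weight M (strip c j k) +_) (cong₂ _+_ (*-comm (c s) s) (*-comm k j)) ⟩
    weight M (strip c j k) + (s * c s + j * k)        ≡⟨ rearrange (weight M (strip c j k)) (s * c s) (j * k) ⟩
    weight M (strip c j k) + j * k + s * c s          ≡⟨ cong (_+ s * c s) (weight-∸= M (c [ s ]∸= c s) j≤M k≤) ⟩
    weight M (c [ s ]∸= c s) + s * c s                ≡⟨ weight-∸= M c s≤M ≤-refl ⟩
    weight M c ∎
    where
    open ≡-Reasoning
    rearrange : ∀ u v t → u + (v + t) ≡ u + t + v
    rearrange = solve-∀

  weight-image : ∀ {c} (P : Plan c) → weight M (image P) ≡ weight M c
  weight-image {c} P = begin
    weight M (strip c j k [ p ]+= x [ q ]+= y [ w ]+= z)      ≡⟨ weight-+= M _ z w≤M ⟩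
    weight M (strip c j k [ p ]+= x [ q ]+= y) + w * z        ≡⟨ cong (_+ w * z) (weight-+= M _ y q≤M) ⟩
    weight M (strip c j k [ p ]+= x) + q * y + w * z          ≡⟨ cong (λ u → u + q * y + w * z) (weight-+= M _ x p≤M) ⟩
    weight M (strip c j k) + p * x + q * y + w * z            ≡⟨ rearrange (weight M (strip c j k)) p x q y w z ⟩
    weight M (strip c j k) + (x * p + y * q + z * w)          ≡⟨ cong (weight M (strip c j k) +_) balance ⟨
    weight M (strip c j k) + (c s * s + k * j)                ≡⟨ weight-strip c j≤M k≤ ⟩
    weight M c ∎
    where
    open ≡-Reasoning
    open Plan P
    rearrange : ∀ u p x q y w z → u + p * x + q * y + w * z ≡ u + (x * p + y * q + z * w)
    rearrange = solve-∀

  strip-≤ : ∀ c j k i → strip c j k i ≤ c i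
  strip-≤ c j k i = ≤-trans (∸=-≤ (c [ s ]∸= c s) j k i) (∸=-≤ c s (c s) i)

  strip-≤s : ∀ c j k {i} → (∀ {i} → i < s → c i ≡ 0) → i ≤ s → strip c j k i ≡ 0
  strip-≤s c j k {i} below i≤s = n≤0⇒n≡0 (≤-trans (∸=-≤ (c [ s ]∸= c s) j k i) stripped-s)
    where
    stripped-s : (c [ s ]∸= c s) i ≤ 0
    stripped-s with i ≟ s
    ... | yes refl = ≤-reflexive (n∸n≡0 (c i))
    ... | no  i≢s  = ≤-reflexive (below (≤∧≢⇒< i≤s i≢s))

  image-p : ∀ {c} (P : Plan c) → c p ≡ 0 → image P p ≡ Plan.x P
  image-p {c} P cp≡0 = begin
    (strip c j k [ p ]+= x [ q ]+= y [ w ]+= z) p ≡⟨ ≔-≢ _ (w≢p ∘′ sym) ⟩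
    (strip c j k [ p ]+= x [ q ]+= y) p           ≡⟨ ≔-≢ _ p≢q ⟩
    (strip c j k [ p ]+= x) p                     ≡⟨ ≔-≡ _ p _ ⟩
    strip c j k p + x                             ≡⟨ cong (_+ x) (n≤0⇒n≡0 (subst (strip c j k p ≤_) cp≡0 (strip-≤ c j k p))) ⟩
    x ∎
    where
    open ≡-Reasoning
    open Plan P

  image-q : ∀ {c} (P : Plan c) → c q ≡ 0 → image P q ≡ Plan.y P
  image-q {c} P cq≡0 = begin
    (strip c j k [ p ]+= x [ q ]+= y [ w ]+= z) q ≡⟨ ≔-≢ _ (w≢q ∘′ sym) ⟩
    (strip c j k [ p ]+= x [ q ]+= y) q           ≡⟨ ≔-≡ _ q _ ⟩
    (strip c j k [ p ]+= x) q + y                 ≡⟨ cong (_+ y) (≔-≢ _ (p≢q ∘′ sym)) ⟩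
    strip c j k q + y                             ≡⟨ cong (_+ y) (n≤0⇒n≡0 (subst (strip c j k q ≤_) cq≡0 (strip-≤ c j k q))) ⟩
    y ∎
    where
    open ≡-Reasoning
    open Plan P

  image-≤s : ∀ {c} (P : Plan c) → (∀ {i} → i < s → c i ≡ 0) → ∀ {i} → i ≤ s → image P i ≡ 0
  image-≤s {c} P below {i} i≤s = begin
    (strip c j k [ p ]+= x [ q ]+= y [ w ]+= z) i ≡⟨ skip-w s<w⊎f≡0 ⟩
    (strip c j k [ p ]+= x [ q ]+= y) i           ≡⟨ ≔-≢ _ (<⇒≢ (≤-<-trans i≤s s<q)) ⟩
    (strip c j k [ p ]+= x) i                     ≡⟨ ≔-≢ _ (<⇒≢ (≤-<-trans i≤s s<p)) ⟩
    strip c j k i                                 ≡⟨ strip-≤s c j k below i≤s ⟩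
    0 ∎
    where
    open ≡-Reasoning
    open Plan P
    skip-w : s < w ⊎ (∀ r → f r ≡ 0) → (strip c j k [ p ]+= x [ q ]+= y [ w ]+= z) i ≡ (strip c j k [ p ]+= x [ q ]+= y) i
    skip-w (inj₁ s<w) = ≔-≢ _ (<⇒≢ (≤-<-trans i≤s s<w))
    skip-w (inj₂ f≡0) = trans (cong (λ z → (strip c j k [ p ]+= x [ q ]+= y [ w ]+= z) i) (trans z≡f (f≡0 _)))
                              (+=-zero _ w i)

  transform-cong : ∀ c {j₁ j₂ k₁ k₂ x₁ x₂ y₁ y₂ z₁ z₂} → j₁ ≡ j₂ → k₁ ≡ k₂ → x₁ ≡ x₂ → y₁ ≡ y₂ → z₁ ≡ z₂ →
    transform c j₁ k₁ x₁ y₁ z₁ ≡ transform c j₂ k₂ x₂ y₂ z₂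
  transform-cong c refl refl refl refl refl = refl

  transform-cancel : ∀ c₁ c₂ {j k x y z} → k ≤ (c₁ [ s ]∸= c₁ s) j → k ≤ (c₂ [ s ]∸= c₂ s) j → c₁ s ≡ c₂ s →
    ∀ i → transform c₁ j k x y z i ≡ transform c₂ j k x y z i → c₁ i ≡ c₂ i
  transform-cancel c₁ c₂ {j} {k} {x} {y} {z} k≤₁ k≤₂ cs≡ i eq
    with stripped≡ ← ∸=-cancel _ _ j k i k≤₁ k≤₂ (+=-cancel _ _ p x i (+=-cancel _ _ q y i (+=-cancel _ _ w z i eq)))
    with i ≟ s
  ... | yes refl = cs≡
  ... | no  _    = stripped≡

  Plan-determined : ∀ {c₁ c₂} (P₁ : Plan c₁) (P₂ : Plan c₂) → Plan.x P₁ ≡ Plan.x P₂ → Plan.y P₁ ≡ Plan.y P₂ →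
    Plan.j P₁ ≡ Plan.j P₂ × Plan.k P₁ ≡ Plan.k P₂ × Plan.z P₁ ≡ Plan.z P₂ × c₁ s ≡ c₂ s
  Plan-determined {c₁} {c₂} P₁ P₂ x≡ y≡ = by-tags P₁.tag P₂.tag
    where
    module P₁ = Plan P₁
    module P₂ = Plan P₂
    z≡ : P₁.z ≡ P₂.z
    z≡ = trans P₁.z≡f (trans (cong (λ y → f (y % p)) y≡) (sym P₂.z≡f))
    removed≡ : c₁ s * s + P₁.k * P₁.j ≡ c₂ s * s + P₂.k * P₂.j
    removed≡ = trans P₁.balance (trans (cong₂ (λ u v → u * p + v * q + P₁.z * w) x≡ y≡)
                 (trans (cong (λ u → P₂.x * p + P₂.y * q + u * w) z≡) (sym P₂.balance)))
    y/p≡ : P₁.y / p ≡ P₂.y / p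
    y/p≡ = cong (_/ p) y≡
    by-tags : (P₁.j ≡ s × P₁.k ≡ 0 × P₁.y < p) ⊎ (1 ≤ P₁.j × P₁.y / p ≡ suc (P₁.j + c₁ s * suc M)) →
              (P₂.j ≡ s × P₂.k ≡ 0 × P₂.y < p) ⊎ (1 ≤ P₂.j × P₂.y / p ≡ suc (P₂.j + c₂ s * suc M)) →
              P₁.j ≡ P₂.j × P₁.k ≡ P₂.k × P₁.z ≡ P₂.z × c₁ s ≡ c₂ s
    by-tags (inj₁ (j₁≡s , k₁≡0 , _)) (inj₁ (j₂≡s , k₂≡0 , _)) =
      trans j₁≡s (sym j₂≡s) , trans k₁≡0 (sym k₂≡0) , z≡ , *-cancelʳ-≡ (c₁ s) (c₂ s) s (begin
        c₁ s * s               ≡⟨ +-identityʳ (c₁ s * s) ⟨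
        c₁ s * s + 0 * P₁.j    ≡⟨ cong (λ k → c₁ s * s + k * P₁.j) k₁≡0 ⟨
        c₁ s * s + P₁.k * P₁.j ≡⟨ removed≡ ⟩
        c₂ s * s + P₂.k * P₂.j ≡⟨ cong (λ k → c₂ s * s + k * P₂.j) k₂≡0 ⟩
        c₂ s * s + 0 * P₂.j    ≡⟨ +-identityʳ (c₂ s * s) ⟩
        c₂ s * s ∎)
      where
      open ≡-Reasoning
    by-tags (inj₁ (_ , _ , y₁<p)) (inj₂ (_ , y₂/p≡)) = ⊥-elim (0≢1+n (trans (sym (m<n⇒m/n≡0 y₁<p)) (trans y/p≡ y₂/p≡)))
    by-tags (inj₂ (_ , y₁/p≡)) (inj₁ (_ , _ , y₂<p)) = ⊥-elim (0≢1+n (trans (sym (m<n⇒m/n≡0 y₂<p)) (trans (sym y/p≡) y₁/p≡)))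
    by-tags (inj₂ (1≤j₁ , y₁/p≡)) (inj₂ (_ , y₂/p≡)) = j≡ , k≡ , z≡ , cs≡
      where
      code≡ : P₁.j + c₁ s * suc M ≡ P₂.j + c₂ s * suc M
      code≡ = suc-injective (trans (sym y₁/p≡) (trans y/p≡ y₂/p≡))
      j≡ : P₁.j ≡ P₂.j
      j≡ = trans (sym ([m+kn]%n≡m (c₁ s) (s≤s P₁.j≤M))) (trans (cong (_% suc M) code≡) ([m+kn]%n≡m (c₂ s) (s≤s P₂.j≤M)))
      cs≡ : c₁ s ≡ c₂ s
      cs≡ = trans (sym ([m+kn]/n≡k (c₁ s) (s≤s P₁.j≤M))) (trans (cong (_/ suc M) code≡) ([m+kn]/n≡k (c₂ s) (s≤s P₂.j≤M)))
      k≡ : P₁.k ≡ P₂.k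
      k≡ = *-cancelʳ-≡ P₁.k P₂.k P₁.j {{>-nonZero 1≤j₁}}
             (+-cancelˡ-≡ (c₁ s * s) _ _ (trans removed≡ (cong₂ (λ u v → u * s + P₂.k * v) (sym cs≡) (sym j≡))))

  image-injective : ∀ {c₁ c₂} (P₁ : Plan c₁) (P₂ : Plan c₂) → c₁ p ≡ 0 → c₁ q ≡ 0 → c₂ p ≡ 0 → c₂ q ≡ 0 →
    image P₁ ≗⟨ M ⟩ image P₂ → c₁ ≗⟨ M ⟩ c₂
  image-injective {c₁} {c₂} P₁ P₂ c₁p c₁q c₂p c₂q same {i} 1≤i i≤M
    with x≡ ← trans (sym (image-p P₁ c₁p)) (trans (same 1≤p p≤M) (image-p P₂ c₂p))
       | y≡ ← trans (sym (image-q P₁ c₁q)) (trans (same 1≤q q≤M) (image-q P₂ c₂q))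
    with j≡ , k≡ , z≡ , cs≡ ← Plan-determined P₁ P₂ x≡ y≡
    = transform-cancel c₁ c₂ (Plan.k≤ P₁) (subst₂ (λ k j → k ≤ (c₂ [ s ]∸= c₂ s) j) (sym k≡) (sym j≡) (Plan.k≤ P₂)) cs≡ i
        (trans (same 1≤i i≤M) (cong-app (transform-cong c₂ (sym j≡) (sym k≡) (sym x≡) (sym y≡) (sym z≡)) i))

  plan-many-s : ∀ c → K₀ ≤ c s * s → Plan c
  plan-many-s c K₀≤ with x , r , r<p , T≡ ← represent (c s * s) K₀≤ = record
    { j = s ; k = 0 ; x = x ; y = r ; z = f r ; j≤M = s≤M ; k≤ = z≤n
    ; balance = trans (+-identityʳ (c s * s)) T≡ ; z≡f = cong f (sym (m<n⇒m%n≡m r<p)) ; tag = inj₁ (refl , refl , r<p) }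

  represent-above : ∀ T P → K₀ + P ≤ T → ∃₂ λ x r → r < p × T ≡ x * p + r * q + f r * w + P
  represent-above T P K₀+P≤T
    with x , r , r<p , T-P≡ ← represent (T ∸ P) (subst (_≤ T ∸ P) (m+n∸n≡m K₀ P) (∸-monoˡ-≤ P K₀+P≤T))
    = x , r , r<p , trans (sym (m∸n+n≡m (≤-trans (m≤n+m P K₀) K₀+P≤T))) (cong (_+ P) T-P≡)

  plan-shifted : ∀ c {j k} → 1 ≤ j → j ≤ M → k ≤ (c [ s ]∸= c s) j →
    K₀ + suc (j + c s * suc M) * p * q ≤ c s * s + k * j → Plan c
  plan-shifted c {j} {k} 1≤j j≤M k≤ bound
    with x , r , r<p , T≡ ← represent-above (c s * s + k * j) (suc (j + c s * suc M) * p * q) bound = record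
    { j = j ; k = k ; x = x ; y = r + suc (j + c s * suc M) * p ; z = f r ; j≤M = j≤M ; k≤ = k≤
    ; balance = trans T≡ (regroup x p r q (f r) w (suc (j + c s * suc M)))
    ; z≡f = cong f (sym ([m+kn]%n≡m (suc (j + c s * suc M)) r<p))
    ; tag = inj₂ (1≤j , [m+kn]/n≡k (suc (j + c s * suc M)) r<p) }
    where
    regroup : ∀ x p r q z w n → x * p + r * q + z * w + n * p * q ≡ x * p + (r + n * p) * q + z * w
    regroup = solve-∀

  -- Removing k = 1 + Q div j parts j removes more than Q = K₀ + (1 + code) p q, the amount plan-shifted needs.
  plan-large-part : ∀ c j → 1 ≤ j → j ≤ M → c s < K₀ → Q-max + M < j * (c [ s ]∸= c s) j → Plan c
  plan-large-part c j 1≤j j≤M cs<K₀ big =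
    plan-shifted c 1≤j j≤M k≤ (≤-trans (<⇒≤ (m<[1+m/n]*n Q j)) (m≤n+m (suc (Q / j) * j) (c s * s)))
    where
    instance
      j-nonZero : NonZero j
      j-nonZero = >-nonZero 1≤j
    Q : ℕ
    Q = K₀ + suc (j + c s * suc M) * p * q
    1+code≤K₀[1+M] : suc (j + c s * suc M) ≤ K₀ * suc M
    1+code≤K₀[1+M] = begin
      suc j + c s * suc M   ≤⟨ +-monoˡ-≤ (c s * suc M) (s≤s j≤M) ⟩
      suc M + c s * suc M   ≤⟨ *-monoˡ-≤ (suc M) cs<K₀ ⟩
      K₀ * suc M ∎
      where
      open ≤-Reasoning
    k≤ : suc (Q / j) ≤ (c [ s ]∸= c s) j
    k≤ = *-cancelˡ-≤ j (begin
      j * suc (Q / j)        ≤⟨ n*[1+m/n]≤n+m Q j ⟩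
      j + Q                  ≤⟨ +-mono-≤ j≤M (+-monoʳ-≤ K₀ (*-mono-≤ (*-mono-≤ 1+code≤K₀[1+M] p≤M) q≤M)) ⟩
      M + Q-max              ≡⟨ +-comm M Q-max ⟩
      Q-max + M              <⟨ big ⟩
      j * (c [ s ]∸= c s) j  ∎)
      where
      open ≤-Reasoning

  plan : ∀ c → N₀ ≤ weight M c → Plan c
  plan c N₀≤w with K₀ ≤? c s * s
  ... | yes K₀≤ = plan-many-s c K₀≤
  ... | no  K₀≰ with weight-pigeonhole M (c [ s ]∸= c s) (Q-max + M) stripped-heavy
    where
    stripped-heavy : M * (Q-max + M) < weight M (c [ s ]∸= c s)
    stripped-heavy = +-cancelˡ-< K₀ _ _ (begin-strict
      K₀ + M * (Q-max + M)                      ≤⟨ N₀≤w ⟩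
      weight M c                                ≡⟨ weight-∸= M c s≤M ≤-refl ⟨
      weight M (c [ s ]∸= c s) + s * c s        <⟨ +-monoʳ-< (weight M (c [ s ]∸= c s)) (subst (_< K₀) (*-comm (c s) s) (≰⇒> K₀≰)) ⟩
      weight M (c [ s ]∸= c s) + K₀             ≡⟨ +-comm _ K₀ ⟩
      K₀ + weight M (c [ s ]∸= c s) ∎)
      where
      open ≤-Reasoning
  ...   | zero  , _   , ()
  ...   | suc j , j≤M , big = plan-large-part c (suc j) (s≤s z≤n) j≤M (≤-<-trans (m≤m*n (c s) s) (≰⇒> K₀≰)) big

SmallestPart⇒All≥ : ∀ {m π s} → SmallestPart π s → Descending m π → All (s ≤_) π
SmallestPart⇒All≥ last-one (dcons _ _ _) = ≤-refl ∷ []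
SmallestPart⇒All≥ (cons sp) (dcons _ _ d@(dcons _ y≤x _)) with s≤y ∷ s≤rest ← SmallestPart⇒All≥ sp d =
  ≤-trans s≤y y≤x ∷ s≤y ∷ s≤rest

NonEmpty-sum : ∀ {π} → 1 ≤ sum π → NonEmpty π
NonEmpty-sum {x ∷ π} _ = ne

module _ (L s N : ℕ) .{{_ : NonZero s}} {V : List ℕ} {a b : ℕ} (a∈V : a ∈ V) (b∈V : b ∈ V)
         (s<a : s < a) (a<b : a < b) (b≤M : b ≤ L + s) where
  private
    M : ℕ
    M = L + s
    R : Representation s M a b
    R = representation s<a a<b b≤M
  open Representation R
  open Encoding s M R

  record Candidate (π : List ℕ) : Set where
    field
      descending : Descending M π
      below-s : ∀ {i} → i < s → multiplicity π i ≡ 0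
      no-p : multiplicity π p ≡ 0
      no-q : multiplicity π q ≡ 0
      weight≡N : weight M (multiplicity π) ≡ N

  candidate : ∀ {π} → π ∈ filter (InI? L s V) (partitions N) → Candidate π
  candidate {π} π∈ with π∈partitions , smallest , parts≤M , avoids ← ∈-filter⁻ (InI? L s V) {xs = partitions N} π∈ = record
    { descending = d ; below-s = below-s ; no-p = absent p∈ab ; no-q = absent q∈ab
    ; weight≡N = trans (sym (sum-fromMultiplicities M (multiplicity π)))
                   (trans (cong sum (fromMultiplicities-multiplicity M d)) (proj₂ (pb-sound N N N π∈partitions))) }
    where
    d : Descending M π
    d = Descending-tighten (proj₁ (pb-sound N N N π∈partitions)) parts≤M
    below-s : ∀ {i} → i < s → multiplicity π i ≡ 0
    below-s i<s = ∉⇒multiplicity≡0 (λ i∈ → <⇒≱ i<s (All.lookup (SmallestPart⇒All≥ smallest d) i∈))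
    absent : ∀ {v} → v ≡ a ⊎ v ≡ b → multiplicity π v ≡ 0
    absent (inj₁ refl) = ∉⇒multiplicity≡0 (All.lookup avoids a∈V)
    absent (inj₂ refl) = ∉⇒multiplicity≡0 (All.lookup avoids b∈V)

  M≤N₀ : M ≤ N₀
  M≤N₀ = ≤-trans (m≤m*n M (Q-max + M)) (m≤n+m (M * (Q-max + M)) K₀)
    where
    instance
      nonZero : NonZero (Q-max + M)
      nonZero = >-nonZero (≤-trans (≤-trans (s≤s z≤n) (≤-trans a<b b≤M)) (m≤n+m M Q-max))

  module _ (N₀≤N : N₀ ≤ N) where

    plan-of : ∀ {π} → π ∈ filter (InI? L s V) (partitions N) → Plan (multiplicity π)
    plan-of π∈ = plan _ (subst (N₀ ≤_) (sym (Candidate.weight≡N (candidate π∈))) N₀≤N)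

    encode : ∀ {π} → π ∈ filter (InI? L s V) (partitions N) → List ℕ
    encode π∈ = fromMultiplicities M (image (plan-of π∈))

    encode∈D : ∀ {π} (π∈ : π ∈ filter (InI? L s V) (partitions N)) → encode π∈ ∈ filter (InD? L s) (partitions N)
    encode∈D {π} π∈ = ∈-filter⁺ (InD? L s)
      (pb-complete N N N (Descending-weaken (≤-trans M≤N₀ N₀≤N) (Descending-fromMultiplicities M d)) sum≡N ≤-refl)
      (NonEmpty-sum (subst (1 ≤_) (sym sum≡N) 1≤N) , All.tabulate parts-in-range)
      where
      d : ℕ → ℕ
      d = image (plan-of π∈)
      sum≡N : sum (fromMultiplicities M d) ≡ N
      sum≡N = trans (sum-fromMultiplicities M d) (trans (weight-image (plan-of π∈)) (Candidate.weight≡N (candidate π∈)))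
      1≤N : 1 ≤ N
      1≤N = ≤-trans (≤-trans (s≤s z≤n) (≤-trans (≤-trans s<a (<⇒≤ a<b)) b≤M)) (≤-trans M≤N₀ N₀≤N)
      parts-in-range : ∀ {x} → x ∈ fromMultiplicities M d → s < x × x ≤ L + s
      parts-in-range x∈ with _ , x≤M , dx≢0 ← ∈-fromMultiplicities⁻ M d x∈ =
        ≰⇒> (λ x≤s → dx≢0 (image-≤s (plan-of π∈) (Candidate.below-s (candidate π∈)) x≤s)) , x≤M

    encode-injective : ∀ {π₁ π₂} (π₁∈ : π₁ ∈ filter (InI? L s V) (partitions N)) (π₂∈ : π₂ ∈ filter (InI? L s V) (partitions N)) →
      encode π₁∈ ≡ encode π₂∈ → π₁ ≡ π₂
    encode-injective {π₁} {π₂} π₁∈ π₂∈ eq = begin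
      π₁                                        ≡⟨ fromMultiplicities-multiplicity M C₁.descending ⟨
      fromMultiplicities M (multiplicity π₁)    ≡⟨ fromMultiplicities-cong M multiplicities≡ ⟩
      fromMultiplicities M (multiplicity π₂)    ≡⟨ fromMultiplicities-multiplicity M C₂.descending ⟩
      π₂ ∎
      where
      open ≡-Reasoning
      module C₁ = Candidate (candidate π₁∈)
      module C₂ = Candidate (candidate π₂∈)
      images≡ : image (plan-of π₁∈) ≗⟨ M ⟩ image (plan-of π₂∈)
      images≡ {i} 1≤i i≤M = trans (sym (multiplicity-fromMultiplicities M _ 1≤i i≤M))
        (trans (cong (λ l → multiplicity l i) eq) (multiplicity-fromMultiplicities M _ 1≤i i≤M))
      multiplicities≡ : multiplicity π₁ ≗⟨ M ⟩ multiplicity π₂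
      multiplicities≡ = image-injective (plan-of π₁∈) (plan-of π₂∈) C₁.no-p C₁.no-q C₂.no-p C₂.no-q images≡

    encoding-injection : countI L s V N ≤ countD L s N
    encoding-injection = length-≤-injection (Unique.filter⁺ (InI? L s V) (pb-unique N N N)) _ encode encode∈D encode-injective

  countI≤countD : 2 * M ^ 7 + M ^ 5 ≤ N → countI L s V N ≤ countD L s N
  countI≤countD bound = encoding-injection (≤-trans (N₀≤2M⁷+M⁵ M 2≤M) bound)
    where
    2≤M : 2 ≤ M
    2≤M = ≤-trans (s≤s (≤-trans (s≤s z≤n) s<a)) (≤-trans a<b b≤M)

two-increasing : ∀ {V : List ℕ} → Unique V → 2 ≤ length V → ∃₂ λ a b → a ∈ V × b ∈ V × a < b
two-increasing {_ ∷ []} _ (s≤s ())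
two-increasing {v₁ ∷ v₂ ∷ _} ((v₁≢v₂ ∷ _) ∷ _) _ with <-cmp v₁ v₂
... | tri< v₁<v₂ _ _ = v₁ , v₂ , here refl , there (here refl) , v₁<v₂
... | tri≈ _ v₁≡v₂ _ = ⊥-elim (v₁≢v₂ v₁≡v₂)
... | tri> _ _ v₂<v₁ = v₂ , v₁ , there (here refl) , here refl , v₂<v₁

theorem3 : (L s : ℕ) → 1 ≤ L → 1 ≤ s → (V : List ℕ) → Unique V
    → All (λ v → s < v × v ≤ L + s) V → 2 ≤ length V
    → (N : ℕ) → 2 * (L + s) ^ 7 + (L + s) ^ 5 ≤ N
    → countI L s V N ≤ countD L s N
theorem3 L (suc s′) _ _ V unique in-range 2≤|V| N bound
  with a , b , a∈V , b∈V , a<b ← two-increasing unique 2≤|V| =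
  countI≤countD L (suc s′) N a∈V b∈V (proj₁ (All.lookup in-range a∈V)) a<b (proj₂ (All.lookup in-range b∈V)) bound
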